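{- Let $G$ be a connected graph with $\operatorname{th_+^\times}(G)<|V(G)|$, and let $S^*,S^\times\subseteq V(G)$ satisfy $\operatorname{th_+^\times}(G)=|S^\times|(1+\operatorname{pt_+}(G;S^\times))$ and $\operatorname{th_+^*}(G)=|S^*|\operatorname{pt_+}(G;S^*)$. Then (1) $\operatorname{pt_+}(G;S^*)=\operatorname{pt_+}(G,|S^*|)$ and $\operatorname{pt_+}(G;S^\times)=\operatorname{pt_+}(G,|S^\times|)$; (2) $|S^*|\geq|S^\times|$; (3) $\operatorname{pt_+}(G;S^*)\leq\operatorname{pt_+}(G;S^\times)$; (4) if $|S^*|=|S^\times|$, then $\operatorname{th_+^*}(G)=|S^\times|\operatorname{pt_+}(G;S^\times)$ and $\operatorname{th_+^\times}(G)=|S^*|(1+\operatorname{pt_+}(G;S^*))$.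
   Context: All graphs are finite and simple. PSD color change rule: given a set $B$ of blue vertices (others white), let $W_1,\dots,W_k$ be the vertex sets of the components of $G-B$; if $u\in B$ and $w\in W_i$ is the only white neighbor of $u$ in $G[W_i\cup B]$, then $u$ can force $w$. For $S\subseteq V(G)$, $S^{[0]}=S$ and $S^{[i]}=S^{[i-1]}\cup\{w\notin S^{[i-1]}: w$ can be forced given blue set $S^{[i-1]}\}$. $S$ is a PSD forcing set if $S^{[i]}=V(G)$ for some $i$; $\operatorname{pt_+}(G;S)$ is the least such $i$ ($\infty$ if none). $\operatorname{Z_+}(G)$ is the minimum size of a PSD forcing set; $\operatorname{pt_+}(G,k)=\min\{\operatorname{pt_+}(G;S):|S|=k\}$. $\operatorname{th_+^\times}(G)=\min\{|S|(1+\operatorname{pt_+}(G;S)): S\subseteq V(G),|S|\ge\operatorname{Z_+}(G)\}$ and $\operatorname{th_+^*}(G)=\min\{|S|\operatorname{pt_+}(G;S): S\subseteq V(G),\ \operatorname{Z_+}(G)\le|S|<|V(G)|\}$. -}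

module Defs where

open import Data.Nat using (ℕ; zero; suc; _*_; _≤_; _<_)
open import Data.Bool using (Bool; true; false; T)
open import Data.Fin using (Fin)
open import Data.Fin.Subset using (Subset; _∈_; ∣_∣)
open import Data.Product using (Σ; Σ-syntax; _×_; _,_)
open import Data.Sum using (_⊎_)
open import Relation.Nullary using (¬_)
open import Relation.Binary.PropositionalEquality using (_≡_)

record Graph (n : ℕ) : Set where
  field
    adj    : Fin n → Fin n → Bool
    sym    : ∀ u v → adj u v ≡ adj v u
    irrefl : ∀ u → adj u u ≡ false
open Graph public

module _ {n : ℕ} (G : Graph n) where

  Adj : Fin n → Fin n → Set
  Adj u v = T (adj G u v)

  data WalkIn (P : Fin n → Set) : Fin n → Fin n → Set where
    here : ∀ {u} → P u → WalkIn P u u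
    step : ∀ {u w v} → P u → Adj u w → WalkIn P w v → WalkIn P u v

  Connected : Set
  Connected = ∀ u v → WalkIn (λ _ → ⊤′) u v
    where open import Data.Unit using () renaming (⊤ to ⊤′)

  White : (Fin n → Set) → Fin n → Set
  White B v = ¬ B v

  -- PSD color change rule: with blue set B, u can force w iff u is blue,
  -- w is white, u ~ w, and w is the only white neighbour of u inside the
  -- component of G - B containing w.
  CanForce : (Fin n → Set) → Fin n → Fin n → Set
  CanForce B u w =
    B u × White B w × Adj u w ×
    (∀ x → WalkIn (White B) w x → Adj u x → x ≡ w)

  Forced : (Fin n → Set) → Fin n → Set
  Forced B w = Σ[ u ∈ Fin n ] CanForce B u w

  Iter : Subset n → ℕ → Fin n → Set
  Iter S zero    v = v ∈ S
  Iter S (suc i) v = Iter S i v ⊎ Forced (Iter S i) v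

  AllBlue : Subset n → ℕ → Set
  AllBlue S i = ∀ v → Iter S i v

  PT : Subset n → ℕ → Set
  PT S t = AllBlue S t × (∀ i → i < t → ¬ AllBlue S i)

  IsPSDForcing : Subset n → Set
  IsPSDForcing S = Σ[ t ∈ ℕ ] AllBlue S t

  IsZplus : ℕ → Set
  IsZplus z = (Σ[ S ∈ Subset n ] IsPSDForcing S × ∣ S ∣ ≡ z)
            × (∀ S → IsPSDForcing S → z ≤ ∣ S ∣)

  ZplusLe : ℕ → Set
  ZplusLe k = Σ[ z ∈ ℕ ] IsZplus z × z ≤ k

  -- pt_+(G,k) = t  (minimum over |S| = k; sets with pt = ∞ never attain it)
  IsPTk : ℕ → ℕ → Set
  IsPTk k t = (Σ[ S ∈ Subset n ] ∣ S ∣ ≡ k × PT S t)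
            × (∀ S q → ∣ S ∣ ≡ k → PT S q → t ≤ q)

  IsThX : ℕ → Set
  IsThX t = (Σ[ S ∈ Subset n ] Σ[ p ∈ ℕ ] ZplusLe ∣ S ∣ × PT S p × t ≡ ∣ S ∣ * suc p)
          × (∀ S p → ZplusLe ∣ S ∣ → PT S p → t ≤ ∣ S ∣ * suc p)

  IsThStar : ℕ → Set
  IsThStar t = (Σ[ S ∈ Subset n ] Σ[ p ∈ ℕ ] ZplusLe ∣ S ∣ × ∣ S ∣ < n × PT S p × t ≡ ∣ S ∣ * p)
             × (∀ S p → ZplusLe ∣ S ∣ → ∣ S ∣ < n → PT S p → t ≤ ∣ S ∣ * p)

{-# OPTIONS --safe #-}
module Submission where

open import Defs hiding (sym)
open import Data.Nat using (ℕ; zero; suc; _*_; _+_; _≤_; _<_; z≤n; s≤s; >-nonZero; >-nonZero⁻¹)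
open import Data.Nat.Properties
open import Data.Fin using (fromℕ<)
open import Data.Fin.Subset using (Subset; ∣_∣; _∈_; ⊤)
open import Data.Fin.Subset.Properties
  using (∣p∣≤n; ∣p∣≡n⇒p≡⊤; ∈⊤; ∣⊤∣≡n; p⊆q⇒∣p∣≤∣q∣; x∈p⇒∣p-x∣<∣p∣)
open import Data.Product using (_×_; _,_; proj₁; proj₂; ∃-syntax)
open import Data.Sum using (inj₁; inj₂)
open import Relation.Nullary using (contradiction)
open import Relation.Binary.PropositionalEquality
  using (_≡_; refl; sym; trans; subst; subst₂; cong; cong₂)

-- Write a = |S*|, b = |S×|, p = pt(S*), q = pt(S×).  Since S× and S* are
-- admissible for th₊* and th₊× respectively (b ≤ b (1 + q) < n), optimality
-- gives  a p ≤ b q  and  b (1 + q) ≤ a (1 + p); the four claims are arithmetic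
-- consequences of these, using a, b ≥ 1.  Admissibility of S* itself, and hence
-- minimality of p among sets of size a, needs a < n: th₊* > 0 forces p > 0,
-- and only the whole vertex set is blue at time 0.

0<m*n⇒0<n : ∀ m {n} → 0 < m * n → 0 < n
0<m*n⇒0<n m {n} 0<mn = >-nonZero⁻¹ n {{m*n≢0⇒n≢0 m {{>-nonZero 0<mn}}}}

module ThresholdComparison {a b p q : ℕ} (0<b : 0 < b) (ap≤bq : a * p ≤ b * q)
         (b[1+q]≤a[1+p] : b * suc q ≤ a * suc p) where

  thresholds-size : b ≤ a
  thresholds-size = +-cancelʳ-≤ (b * q) b a (begin
    b + b * q   ≡⟨ *-suc b q ⟨
    b * suc q   ≤⟨ b[1+q]≤a[1+p] ⟩
    a * suc p   ≡⟨ *-suc a p ⟩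
    a + a * p   ≤⟨ +-monoʳ-≤ a ap≤bq ⟩
    a + b * q   ∎)
    where open ≤-Reasoning

  thresholds-time : p ≤ q
  thresholds-time = ≮⇒≥ λ q<p → <⇒≱ (*-monoʳ-< b {{>-nonZero 0<b}} (n<1+n q)) (begin
    b * suc q   ≤⟨ *-monoʳ-≤ b q<p ⟩
    b * p       ≤⟨ *-monoˡ-≤ p thresholds-size ⟩
    a * p       ≤⟨ ap≤bq ⟩
    b * q       ∎)
    where open ≤-Reasoning

  thresholds-equal : a ≡ b → p ≡ q
  thresholds-equal refl = ≤-antisym thresholds-time
    (≤-pred (*-cancelˡ-≤ b {{>-nonZero 0<b}} b[1+q]≤a[1+p]))

module _ {n : ℕ} (G : Graph n) where

  Iter⇒seed : ∀ S i {v} → Iter G S i v → ∃[ x ] x ∈ S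
  Iter⇒seed S zero    v∈S                     = _ , v∈S
  Iter⇒seed S (suc i) (inj₁ blue)             = Iter⇒seed S i blue
  Iter⇒seed S (suc i) (inj₂ (u , u-blue , _)) = Iter⇒seed S i u-blue

  AllBlue⇒0<∣S∣ : ∀ {S t} → 0 < n → AllBlue G S t → 0 < ∣ S ∣
  AllBlue⇒0<∣S∣ {S} {t} 0<n all =
    let x , x∈S = Iter⇒seed S t (all (fromℕ< 0<n)) in ≤-<-trans z≤n (x∈p⇒∣p-x∣<∣p∣ x∈S)

  AllBlue₀⇒n≤∣S∣ : ∀ {S} → AllBlue G S 0 → n ≤ ∣ S ∣
  AllBlue₀⇒n≤∣S∣ {S} all = subst (_≤ ∣ S ∣) (∣⊤∣≡n n) (p⊆q⇒∣p∣≤∣q∣ {p = ⊤} (λ {x} _ → all x))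

  PT-proper⇒0<pt : ∀ {S p} → ∣ S ∣ < n → PT G S p → 0 < p
  PT-proper⇒0<pt {p = zero}  ∣S∣<n (all , _) = contradiction (AllBlue₀⇒n≤∣S∣ all) (<⇒≱ ∣S∣<n)
  PT-proper⇒0<pt {p = suc _} _     _         = s≤s z≤n

  0<pt⇒proper : ∀ {S p} → 0 < p → PT G S p → ∣ S ∣ < n
  0<pt⇒proper {S} 0<p (_ , early) with m≤n⇒m<n∨m≡n (∣p∣≤n S)
  ... | inj₁ ∣S∣<n = ∣S∣<n
  ... | inj₂ ∣S∣≡n = contradiction (λ v → subst (v ∈_) (sym (∣p∣≡n⇒p≡⊤ ∣S∣≡n)) ∈⊤) (early 0 0<p)

  PT⇒ZplusLe : ∀ {k S p} → ZplusLe G k → PT G S p → ZplusLe G ∣ S ∣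
  PT⇒ZplusLe (z , isZ , _) (all , _) = z , isZ , proj₂ isZ _ (_ , all)

  IsThStar⇒0< : ∀ {t} → 0 < n → IsThStar G t → 0 < t
  IsThStar⇒0< 0<n ((S , p , _ , ∣S∣<n , pt , t≡) , _) = subst (0 <_) (sym t≡)
    (*-mono-≤ (AllBlue⇒0<∣S∣ 0<n (proj₁ pt)) (PT-proper⇒0<pt ∣S∣<n pt))

  IsThStar-attained⇒IsPTk : ∀ {t S p} → IsThStar G t → 0 < ∣ S ∣ → ∣ S ∣ < n →
    PT G S p → t ≡ ∣ S ∣ * p → IsPTk G ∣ S ∣ p
  IsThStar-attained⇒IsPTk ((_ , _ , Z≤ , _) , optimal) 0<∣S∣ ∣S∣<n pt t≡ =
    (_ , refl , pt) , λ S′ q′ ∣S′∣≡ pt′ → *-cancelˡ-≤ _ {{>-nonZero 0<∣S∣}}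
      (subst₂ _≤_ t≡ (cong (_* q′) ∣S′∣≡)
        (optimal S′ q′ (PT⇒ZplusLe Z≤ pt′) (subst (_< n) (sym ∣S′∣≡) ∣S∣<n) pt′))

  IsThX-attained⇒IsPTk : ∀ {t S p} → IsThX G t → 0 < ∣ S ∣ →
    PT G S p → t ≡ ∣ S ∣ * suc p → IsPTk G ∣ S ∣ p
  IsThX-attained⇒IsPTk ((_ , _ , Z≤ , _) , optimal) 0<∣S∣ pt t≡ =
    (_ , refl , pt) , λ S′ q′ ∣S′∣≡ pt′ → ≤-pred (*-cancelˡ-≤ _ {{>-nonZero 0<∣S∣}}
      (subst₂ _≤_ t≡ (cong (_* suc q′) ∣S′∣≡) (optimal S′ q′ (PT⇒ZplusLe Z≤ pt′) pt′)))

mainTheorem4 : ∀ {n} (G : Graph n) → Connected G →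
    (tx ts : ℕ) → IsThX G tx → IsThStar G ts → tx < n →
    (S* Sx : Subset n) (p* px : ℕ) → PT G S* p* → PT G Sx px →
    tx ≡ ∣ Sx ∣ * suc px → ts ≡ (∣ S* ∣) * p* →
    (IsPTk G (∣ S* ∣) p* × IsPTk G (∣ Sx ∣) px)
    × ∣ Sx ∣ ≤ ∣ S* ∣
    × p* ≤ px
    × (∣ S* ∣ ≡ ∣ Sx ∣ → ts ≡ ∣ Sx ∣ * px × tx ≡ ∣ S* ∣ * suc p*)
mainTheorem4 {n} G _ tx ts thX@((_ , _ , Z≤ , _) , optimalX) thS@(_ , optimalS) tx<n
  S* Sx p* px pt* ptx tx≡ ts≡ =
  ( IsThStar-attained⇒IsPTk G thS 0<a a<n pt* ts≡
  , IsThX-attained⇒IsPTk G thX 0<b ptx tx≡ )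
  , thresholds-size
  , thresholds-time
  , λ a≡b → let p≡q = thresholds-equal a≡b in
      trans ts≡ (cong₂ _*_ a≡b p≡q) , trans tx≡ (cong₂ _*_ (sym a≡b) (cong suc (sym p≡q)))
  where
  a b : ℕ
  a = ∣ S* ∣
  b = ∣ Sx ∣
  0<n : 0 < n
  0<n = ≤-<-trans z≤n tx<n
  0<a : 0 < a
  0<a = AllBlue⇒0<∣S∣ G 0<n (proj₁ pt*)
  0<b : 0 < b
  0<b = AllBlue⇒0<∣S∣ G 0<n (proj₁ ptx)
  0<p* : 0 < p*
  0<p* = 0<m*n⇒0<n a (subst (0 <_) ts≡ (IsThStar⇒0< G 0<n thS))
  a<n : a < n
  a<n = 0<pt⇒proper G 0<p* pt*
  b<n : b < n
  b<n = ≤-<-trans (subst (b ≤_) (sym tx≡) (m≤m*n b (suc px))) tx<n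
  ap≤bq : a * p* ≤ b * px
  ap≤bq = subst (_≤ b * px) ts≡ (optimalS Sx px (PT⇒ZplusLe G Z≤ ptx) b<n ptx)
  b[1+q]≤a[1+p] : b * suc px ≤ a * suc p*
  b[1+q]≤a[1+p] = subst (_≤ a * suc p*) tx≡ (optimalX S* p* (PT⇒ZplusLe G Z≤ pt*) pt*)
  open ThresholdComparison {a} {b} {p*} {px} 0<b ap≤bq b[1+q]≤a[1+p]
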